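{- Let $q$ be a prime power, $\mathbb{F}=\mathbb{F}_q$, $n\ge1$, $b\in\mathbb{F}$. For each $i\in[n]$ let $0\le k_i\le q$ and let $a_{i1},\dots,a_{ik_i}$ be distinct elements of $\mathbb{F}$. Then $f\in\bigcap_{i=1}^n\bigcap_{j=1}^{k_i}\mathcal{C}^i_{a_{ij},b}$ if and only if \[ f=Q\prod_{i=1}^n\prod_{j=1}^{k_i}(x_i-a_{ij})+b \] for some polynomial $Q$ with $\deg(Q)_i\le q-k_i-1$ for $i=1,\dots,n$.
   Context: $[n]=\{1,\dots,n\}$. $\mathcal{C}^i_{a,b}$ denotes the set of all functions $f:\mathbb{F}^n\to\mathbb{F}$ with $f(x_1,\dots,x_{i-1},a,x_{i+1},\dots,x_n)=b$ for all $(x_1,\dots,x_n)\in\mathbb{F}^n$. Functions $\mathbb{F}^n\to\mathbb{F}$ are identified with polynomials over $\mathbb{F}$ of degree at most $q-1$ in each variable; equalities are equalities of functions on $\mathbb{F}^n$. $\deg(Q)_i$ is the degree of $Q$ in $x_i$ (a negative bound means $Q=0$). -}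

module Defs where

open import Level using (_⊔_)
open import Algebra.Bundles using (CommutativeRing)
open import Data.Nat using (ℕ; zero; suc)
open import Data.Fin using (Fin; zero; suc; toℕ; _≟_)
open import Data.Integer using (ℤ; +_; _<_)
open import Data.Product using (∃)
open import Data.Vec.Functional using (_∷_)
open import Relation.Nullary using (¬_; yes; no)
import Relation.Binary.PropositionalEquality as ≡
open import Function.Bundles using (Bijection)

module _ {c ℓ} (R : CommutativeRing c ℓ) where
  open CommutativeRing R using (Carrier; _≈_; _+_; _*_; 0#; 1#; setoid)

  record IsFiniteField (q : ℕ) : Set (c ⊔ ℓ) where
    field
      1≉0         : ¬ (1# ≈ 0#)
      inverse     : ∀ x → ¬ (x ≈ 0#) → ∃ λ y → x * y ≈ 1#
      enumeration : Bijection (≡.setoid (Fin q)) setoid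

  FunCongruent : {n : ℕ} → ((Fin n → Carrier) → Carrier) → Set (c ⊔ ℓ)
  FunCongruent {n} f = ∀ x y → (∀ i → x i ≈ y i) → f x ≈ f y

  ∑ : (m : ℕ) → (Fin m → Carrier) → Carrier
  ∑ zero    g = 0#
  ∑ (suc m) g = g zero + ∑ m (λ i → g (suc i))

  ∏ : (m : ℕ) → (Fin m → Carrier) → Carrier
  ∏ zero    g = 1#
  ∏ (suc m) g = g zero * ∏ m (λ i → g (suc i))

  ∑ᵉ : (q n : ℕ) → ((Fin n → Fin q) → Carrier) → Carrier
  ∑ᵉ q zero    g = g (λ ())
  ∑ᵉ q (suc n) g = ∑ q (λ e → ∑ᵉ q n (λ es → g (e ∷ es)))

  infixr 8 _^_
  _^_ : Carrier → ℕ → Carrier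
  x ^ zero  = 1#
  x ^ suc m = x * (x ^ m)

  -- A polynomial in x_1..x_n of degree ≤ q-1 in each variable,
  -- given by its coefficients: Q e is the coefficient of ∏ x_i^(e i).
  Poly : (q n : ℕ) → Set c
  Poly q n = (Fin n → Fin q) → Carrier

  eval : {q n : ℕ} → Poly q n → (Fin n → Carrier) → Carrier
  eval {q} {n} Q x = ∑ᵉ q n (λ e → Q e * ∏ n (λ i → x i ^ toℕ (e i)))

  -- deg(Q)_i ≤ d  (d an integer; d < 0 forces Q = 0)
  DegLe : {q n : ℕ} → Poly q n → Fin n → ℤ → Set ℓ
  DegLe Q i d = ∀ e → d < + toℕ (e i) → Q e ≈ 0#

  setAt : {n : ℕ} → (Fin n → Carrier) → Fin n → Carrier → Fin n → Carrier
  setAt x i a j with j ≟ i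
  ... | yes _ = a
  ... | no  _ = x j

  InC : {n : ℕ} → Fin n → Carrier → Carrier → ((Fin n → Carrier) → Carrier) → Set (c ⊔ ℓ)
  InC i a b f = ∀ x → f (setAt x i a) ≈ b

-- Q is built by Lagrange interpolation, one coordinate at a time. For a coordinate i, put
-- A = {a_i1, …, a_ik} and P(t) = ∏_j (t − a_ij). For every point c ∉ A of the field,
--   M_c(t) = κ_c ∏_{d ∉ A, d ≠ c} (t − d),   κ_c = (∏_{d ∉ A, d ≠ c} (c − d) · P(c))⁻¹,
-- has degree q − k − 1 and satisfies M_c(t) P(t) = [t = c] for every t ∉ A. Hence
--   Q = ∑_s (f(s) − b) ∏_i M_{i,s_i}(x_i)
-- gives Q · ∏_i P_i = f − b at every point none of whose coordinates lies in the corresponding A_i,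
-- and at all other points both f − b and ∏_i P_i vanish. Conversely ∏_i P_i vanishes on every
-- hyperplane x_i = a_ij, so any f of the given shape lies in all the C^i_{a_ij,b}.
module Submission where

open import Defs hiding (_^_)
open import Algebra.Bundles using (CommutativeRing)
open import Data.Nat using (ℕ; _≤_)
open import Data.Fin using (Fin)
open import Data.Integer using (+_; 1ℤ) renaming (_-_ to _-ℤ_)
open import Data.Product using (∃; _×_)
open import Relation.Binary.PropositionalEquality using (_≡_)
open import Function.Bundles using (_⇔_)

open import Data.Nat using (zero; suc; _<_; _∸_; z≤n; s≤s) renaming (_+_ to _+ℕ_)
open import Data.Nat.Properties
  using ( ≤-refl; ≤-trans; n≤1+n; m≤n⇒m≤1+n; m≤m+n; +-suc; +-monoˡ-≤; +-cancelʳ-≤; m∸n+n≡m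
        ; module ≤-Reasoning)
open import Data.Fin using (zero; suc; toℕ; punchIn; punchOut)
import Data.Fin.Properties as Fin
open import Data.Integer using () renaming (_<_ to _<ℤ_)
open import Data.Integer.Properties using ([+m]-[+n]≡m⊖n; ⊖-≥; drop‿+<+)
open import Data.Product using (_,_; proj₁; proj₂)
open import Data.Vec.Functional using (_∷_)
open import Function using (_∘_)
open import Function.Bundles using (Bijection; mk⇔)
open import Function.Definitions using (Injective)
open import Relation.Binary using () renaming (Decidable to Decidable₂)
open import Relation.Binary.PropositionalEquality as ≡ using (_≢_)
open import Relation.Nullary using (¬_; Dec; yes; no; contradiction; ¬?; _×-dec_)
open import Relation.Unary using (Pred; Decidable)
import Algebra.Properties.CommutativeSemigroup as CommutativeSemigroupProperties
import Algebra.Properties.Group as GroupProperties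

count : ∀ {m p} {P : Pred (Fin m) p} → Decidable P → ℕ
count {zero}  P? = 0
count {suc m} P? with P? zero
... | yes _ = suc (count (P? ∘ suc))
... | no  _ = count (P? ∘ suc)

count≤1+count-tail : ∀ {m p} {P : Pred (Fin (suc m)) p} (P? : Decidable P) →
                     count P? ≤ suc (count (P? ∘ suc))
count≤1+count-tail P? with P? zero
... | yes _ = ≤-refl
... | no  _ = n≤1+n _

count-head-false : ∀ {m p} {P : Pred (Fin (suc m)) p} (P? : Decidable P) →
                   ¬ P zero → count P? ≡ count (P? ∘ suc)
count-head-false P? ¬P0 with P? zero
... | yes P0 = contradiction P0 ¬P0
... | no  _  = ≡.refl

mutual
  count-+-injection≤ : ∀ {m m′ p} {P : Pred (Fin m) p} (P? : Decidable P) (g : Fin m′ → Fin m) →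
                       Injective _≡_ _≡_ g → (∀ j → ¬ P (g j)) → count P? +ℕ m′ ≤ m
  count-+-injection≤ {zero} {zero}  P? g g-inj ¬Pg = z≤n
  count-+-injection≤ {zero} {suc _} P? g g-inj ¬Pg with g zero
  ... | ()
  count-+-injection≤ {suc m} {m′} P? g g-inj ¬Pg with Fin.any? (λ j → g j Fin.≟ zero)
  ... | no g≢0 = ≤-trans (+-monoˡ-≤ m′ (count≤1+count-tail P?))
                         (s≤s (count-tail-+-injection≤ P? g g-inj (λ j e → g≢0 (j , e)) ¬Pg))
  count-+-injection≤ {suc m} {zero}   P? g g-inj ¬Pg | yes (() , _)
  count-+-injection≤ {suc m} {suc m′} {P = P} P? g g-inj ¬Pg | yes (j₀ , g[j₀]≡0) = begin
    count P? +ℕ suc m′            ≡⟨ ≡.cong (_+ℕ suc m′) (count-head-false P? ¬P0) ⟩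
    count (P? ∘ suc) +ℕ suc m′    ≡⟨ +-suc _ m′ ⟩
    suc (count (P? ∘ suc) +ℕ m′)  ≤⟨ s≤s (count-tail-+-injection≤ P? (g ∘ punchIn j₀)
                                             g∘punchIn-inj g∘punchIn≢0 (¬Pg ∘ punchIn j₀)) ⟩
    suc m                         ∎
    where
    open ≤-Reasoning
    ¬P0 : ¬ P zero
    ¬P0 = ¬Pg j₀ ∘ ≡.subst P (≡.sym g[j₀]≡0)
    g∘punchIn-inj : Injective _≡_ _≡_ (g ∘ punchIn j₀)
    g∘punchIn-inj = Fin.punchIn-injective j₀ _ _ ∘ g-inj
    g∘punchIn≢0 : ∀ j → g (punchIn j₀ j) ≢ zero
    g∘punchIn≢0 j e = Fin.punchInᵢ≢i j₀ j (g-inj (≡.trans e (≡.sym g[j₀]≡0)))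

  count-tail-+-injection≤ : ∀ {m k p} {P : Pred (Fin (suc m)) p} (P? : Decidable P)
                            (h : Fin k → Fin (suc m)) → Injective _≡_ _≡_ h → (∀ j → h j ≢ zero) →
                            (∀ j → ¬ P (h j)) → count (P? ∘ suc) +ℕ k ≤ m
  count-tail-+-injection≤ {P = P} P? h h-inj h≢0 ¬Ph = count-+-injection≤ (P? ∘ suc) h′ h′-inj ¬Ph′
    where
    h′ : _ → _
    h′ j = punchOut (h≢0 j ∘ ≡.sym)
    h′-inj : Injective _≡_ _≡_ h′
    h′-inj {j} {j′} = h-inj ∘ Fin.punchOut-injective (h≢0 j ∘ ≡.sym) (h≢0 j′ ∘ ≡.sym)
    ¬Ph′ : ∀ j → ¬ P (suc (h′ j))
    ¬Ph′ j = ≡.subst (¬_ ∘ P) (≡.sym (Fin.punchIn-punchOut (h≢0 j ∘ ≡.sym))) (¬Ph j)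

+r-1<+e⇒r≤e : ∀ {r e} → + r -ℤ 1ℤ <ℤ + e → r ≤ e
+r-1<+e⇒r≤e {zero}  _   = z≤n
+r-1<+e⇒r≤e {suc r} r<e = drop‿+<+ r<e

degree-bound : ∀ {q k e} → k ≤ q → + q -ℤ + k -ℤ 1ℤ <ℤ + e → q ≤ e +ℕ k
degree-bound {q} {k} {e} k≤q bound<e = begin
  q           ≡⟨ m∸n+n≡m k≤q ⟨
  q ∸ k +ℕ k  ≤⟨ +-monoˡ-≤ k (+r-1<+e⇒r≤e (≡.subst (λ d → d -ℤ 1ℤ <ℤ + e) q-k≡ bound<e)) ⟩
  e +ℕ k      ∎
  where
  open ≤-Reasoning
  q-k≡ : + q -ℤ + k ≡ + (q ∸ k)
  q-k≡ = ≡.trans ([+m]-[+n]≡m⊖n q k) (⊖-≥ k≤q)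

module BigOperators {r ℓ} (R : CommutativeRing r ℓ) where
  open CommutativeRing R hiding (zero)
  open CommutativeSemigroupProperties +-commutativeSemigroup using () renaming (interchange to +-interchange)
  open CommutativeSemigroupProperties *-commutativeSemigroup using () renaming (interchange to *-interchange)

  ∑-cong : ∀ m {g h : Fin m → Carrier} → (∀ i → g i ≈ h i) → ∑ R m g ≈ ∑ R m h
  ∑-cong zero    g≈h = refl
  ∑-cong (suc m) g≈h = +-cong (g≈h zero) (∑-cong m (g≈h ∘ suc))

  ∑-zero : ∀ m {g : Fin m → Carrier} → (∀ i → g i ≈ 0#) → ∑ R m g ≈ 0#
  ∑-zero zero    g≈0 = refl
  ∑-zero (suc m) g≈0 = trans (+-cong (g≈0 zero) (∑-zero m (g≈0 ∘ suc))) (+-identityˡ 0#)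

  ∑-distrib-+ : ∀ m (g h : Fin m → Carrier) → ∑ R m (λ i → g i + h i) ≈ ∑ R m g + ∑ R m h
  ∑-distrib-+ zero    g h = sym (+-identityˡ 0#)
  ∑-distrib-+ (suc m) g h = trans (+-congˡ (∑-distrib-+ m (g ∘ suc) (h ∘ suc)))
                                  (+-interchange (g zero) (h zero) _ _)

  ∑-*ˡ : ∀ m x (g : Fin m → Carrier) → ∑ R m (λ i → x * g i) ≈ x * ∑ R m g
  ∑-*ˡ zero    x g = sym (zeroʳ x)
  ∑-*ˡ (suc m) x g = trans (+-congˡ (∑-*ˡ m x (g ∘ suc))) (sym (distribˡ x _ _))

  ∑-*ʳ : ∀ m x (g : Fin m → Carrier) → ∑ R m (λ i → g i * x) ≈ ∑ R m g * x
  ∑-*ʳ m x g = trans (∑-cong m (λ i → *-comm (g i) x)) (trans (∑-*ˡ m x g) (*-comm x _))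

  ∑-comm : ∀ m m′ (h : Fin m → Fin m′ → Carrier) →
           ∑ R m (λ i → ∑ R m′ (h i)) ≈ ∑ R m′ (λ j → ∑ R m (λ i → h i j))
  ∑-comm zero    m′ h = sym (∑-zero m′ (λ _ → refl))
  ∑-comm (suc m) m′ h = trans (+-congˡ (∑-comm m m′ (h ∘ suc)))
                              (sym (∑-distrib-+ m′ (h zero) (λ j → ∑ R m (λ i → h (suc i) j))))

  ∑-eq-single : ∀ m (g : Fin m → Carrier) i₀ → (∀ i → i ≢ i₀ → g i ≈ 0#) → ∑ R m g ≈ g i₀
  ∑-eq-single (suc m) g zero     g≈0 =
    trans (+-congˡ (∑-zero m (λ i → g≈0 (suc i) (λ ())))) (+-identityʳ _)
  ∑-eq-single (suc m) g (suc i₀) g≈0 =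
    trans (+-cong (g≈0 zero (λ ()))
                  (∑-eq-single m (g ∘ suc) i₀ (λ i i≢i₀ → g≈0 (suc i) (i≢i₀ ∘ Fin.suc-injective))))
          (+-identityˡ _)

  ∑-toℕ-dropLast : ∀ N (h : ℕ → Carrier) → h N ≈ 0# → ∑ R (suc N) (h ∘ toℕ) ≈ ∑ R N (h ∘ toℕ)
  ∑-toℕ-dropLast zero    h h0≈0 = trans (+-identityʳ _) h0≈0
  ∑-toℕ-dropLast (suc N) h hN≈0 = +-congˡ (∑-toℕ-dropLast N (h ∘ suc) hN≈0)

  ∑ᵉ-cong : ∀ q n {g h : (Fin n → Fin q) → Carrier} → (∀ s → g s ≈ h s) → ∑ᵉ R q n g ≈ ∑ᵉ R q n h
  ∑ᵉ-cong q zero    g≈h = g≈h _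
  ∑ᵉ-cong q (suc n) g≈h = ∑-cong q (λ e → ∑ᵉ-cong q n (λ s → g≈h (e ∷ s)))

  ∑ᵉ-zero : ∀ q n {g : (Fin n → Fin q) → Carrier} → (∀ s → g s ≈ 0#) → ∑ᵉ R q n g ≈ 0#
  ∑ᵉ-zero q zero    g≈0 = g≈0 _
  ∑ᵉ-zero q (suc n) g≈0 = ∑-zero q (λ e → ∑ᵉ-zero q n (λ s → g≈0 (e ∷ s)))

  ∑ᵉ-*ˡ : ∀ q n x (g : (Fin n → Fin q) → Carrier) → ∑ᵉ R q n (λ s → x * g s) ≈ x * ∑ᵉ R q n g
  ∑ᵉ-*ˡ q zero    x g = refl
  ∑ᵉ-*ˡ q (suc n) x g = trans (∑-cong q (λ e → ∑ᵉ-*ˡ q n x _)) (∑-*ˡ q x _)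

  ∑ᵉ-*ʳ : ∀ q n x (g : (Fin n → Fin q) → Carrier) → ∑ᵉ R q n (λ s → g s * x) ≈ ∑ᵉ R q n g * x
  ∑ᵉ-*ʳ q n x g = trans (∑ᵉ-cong q n (λ s → *-comm (g s) x)) (trans (∑ᵉ-*ˡ q n x g) (*-comm x _))

  ∑ᵉ-∑-comm : ∀ q n m (h : (Fin n → Fin q) → Fin m → Carrier) →
              ∑ᵉ R q n (λ s → ∑ R m (h s)) ≈ ∑ R m (λ j → ∑ᵉ R q n (λ s → h s j))
  ∑ᵉ-∑-comm q zero    m h = refl
  ∑ᵉ-∑-comm q (suc n) m h = trans (∑-cong q (λ e → ∑ᵉ-∑-comm q n m _)) (∑-comm q m _)

  ∑ᵉ-comm : ∀ q n n′ (h : (Fin n → Fin q) → (Fin n′ → Fin q) → Carrier) →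
            ∑ᵉ R q n (λ s → ∑ᵉ R q n′ (h s)) ≈ ∑ᵉ R q n′ (λ t → ∑ᵉ R q n (λ s → h s t))
  ∑ᵉ-comm q zero    n′ h = refl
  ∑ᵉ-comm q (suc n) n′ h = trans (∑-cong q (λ e → ∑ᵉ-comm q n n′ (h ∘ (e ∷_))))
                                 (sym (∑ᵉ-∑-comm q n′ q (λ t e → ∑ᵉ R q n (λ s → h (e ∷ s) t))))

  -- Without function extensionality, h has to respect pointwise equality of exponent vectors.
  ∑ᵉ-eq-single : ∀ q n (h : (Fin n → Fin q) → Carrier) (s₀ : Fin n → Fin q) →
                 (∀ s s′ → (∀ i → s i ≡ s′ i) → h s ≈ h s′) →
                 (∀ s i → s i ≢ s₀ i → h s ≈ 0#) → ∑ᵉ R q n h ≈ h s₀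
  ∑ᵉ-eq-single q zero    h s₀ h-cong h≈0 = h-cong _ _ (λ ())
  ∑ᵉ-eq-single q (suc n) h s₀ h-cong h≈0 =
    trans (∑-eq-single q _ (s₀ zero) (λ e e≢ → ∑ᵉ-zero q n (λ s → h≈0 (e ∷ s) zero e≢)))
          (trans (∑ᵉ-eq-single q n (h ∘ (s₀ zero ∷_)) (s₀ ∘ suc)
                   (λ s s′ s≗s′ → h-cong _ _ λ { zero → ≡.refl ; (suc i) → s≗s′ i })
                   (λ s i → h≈0 _ (suc i)))
                 (h-cong _ _ λ { zero → ≡.refl ; (suc i) → ≡.refl }))

  ∏-cong : ∀ m {g h : Fin m → Carrier} → (∀ i → g i ≈ h i) → ∏ R m g ≈ ∏ R m h
  ∏-cong zero    g≈h = refl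
  ∏-cong (suc m) g≈h = *-cong (g≈h zero) (∏-cong m (g≈h ∘ suc))

  ∏-one : ∀ m {g : Fin m → Carrier} → (∀ i → g i ≈ 1#) → ∏ R m g ≈ 1#
  ∏-one zero    g≈1 = refl
  ∏-one (suc m) g≈1 = trans (*-cong (g≈1 zero) (∏-one m (g≈1 ∘ suc))) (*-identityˡ 1#)

  ∏-zero : ∀ m (g : Fin m → Carrier) i → g i ≈ 0# → ∏ R m g ≈ 0#
  ∏-zero (suc m) g zero    gi≈0 = trans (*-congʳ gi≈0) (zeroˡ _)
  ∏-zero (suc m) g (suc i) gi≈0 = trans (*-congˡ (∏-zero m (g ∘ suc) i gi≈0)) (zeroʳ _)

  ∏-distrib-* : ∀ m (g h : Fin m → Carrier) → ∏ R m (λ i → g i * h i) ≈ ∏ R m g * ∏ R m h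
  ∏-distrib-* zero    g h = sym (*-identityˡ 1#)
  ∏-distrib-* (suc m) g h = trans (*-congˡ (∏-distrib-* m (g ∘ suc) (h ∘ suc)))
                                  (*-interchange (g zero) (h zero) _ _)

  ∑ᵉ-∏ : ∀ q n (φ : Fin n → Fin q → Carrier) →
         ∑ᵉ R q n (λ s → ∏ R n (λ i → φ i (s i))) ≈ ∏ R n (λ i → ∑ R q (φ i))
  ∑ᵉ-∏ q zero    φ = refl
  ∑ᵉ-∏ q (suc n) φ =
    trans (∑-cong q (λ e → trans (∑ᵉ-*ˡ q n (φ zero e) _) (*-congˡ (∑ᵉ-∏ q n (φ ∘ suc)))))
          (∑-*ʳ q _ (φ zero))

module Univariate {r ℓ} (R : CommutativeRing r ℓ) where
  open CommutativeRing R hiding (zero)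
  open BigOperators R
  open CommutativeSemigroupProperties +-commutativeSemigroup using () renaming (x∙yz≈y∙xz to x+[y+z]≈y+[x+z])
  open CommutativeSemigroupProperties *-commutativeSemigroup using () renaming (x∙yz≈y∙xz to x*[y*z]≈y*[x*z])
  open import Relation.Binary.Reasoning.Setoid setoid

  infixr 8 _^_
  _^_ : Carrier → ℕ → Carrier
  _^_ = Defs._^_ R

  -- Univariate polynomials are coefficient functions ℕ → Carrier.
  evalCoeffs : ℕ → (ℕ → Carrier) → Carrier → Carrier
  evalCoeffs N p t = ∑ R N (λ e → p (toℕ e) * t ^ toℕ e)

  evalCoeffs-*ˡ : ∀ N x p t → evalCoeffs N (λ e → x * p e) t ≈ x * evalCoeffs N p t
  evalCoeffs-*ˡ N x p t = trans (∑-cong N (λ e → *-assoc x _ _)) (∑-*ˡ N x _)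

  oneCoeffs : ℕ → Carrier
  oneCoeffs zero    = 1#
  oneCoeffs (suc _) = 0#

  mulLinear : Carrier → (ℕ → Carrier) → ℕ → Carrier
  mulLinear v p zero    = - v * p 0
  mulLinear v p (suc e) = p e + - v * p (suc e)

  evalCoeffs-mulLinear : ∀ N v p t → p N ≈ 0# →
                         evalCoeffs (suc N) (mulLinear v p) t ≈ (t - v) * evalCoeffs N p t
  evalCoeffs-mulLinear N v p t pN≈0 = begin
    - v * p 0 * 1# + ∑ R N (λ e → mulLinear v p (suc (toℕ e)) * t ^ suc (toℕ e))
      ≈⟨ +-congˡ (trans (∑-cong N (λ e → expand (p (toℕ e)) (p (suc (toℕ e))) (t ^ toℕ e)))
                 (trans (∑-distrib-+ N _ _) (+-cong (∑-*ˡ N t _) (∑-*ˡ N (- v) _)))) ⟩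
    - v * p 0 * 1# + (t * E + - v * T)      ≈⟨ x+[y+z]≈y+[x+z] _ (t * E) _ ⟩
    t * E + (- v * p 0 * 1# + - v * T)      ≈⟨ +-congˡ (+-congʳ (*-assoc (- v) (p 0) 1#)) ⟩
    t * E + (- v * (p 0 * 1#) + - v * T)    ≈⟨ +-congˡ (distribˡ (- v) _ T) ⟨
    t * E + - v * evalCoeffs (suc N) p t    ≈⟨ +-congˡ (*-congˡ (∑-toℕ-dropLast N (λ e → p e * t ^ e) pNtᴺ≈0)) ⟩
    t * E + - v * E                         ≈⟨ distribʳ E t (- v) ⟨
    (t - v) * E                             ∎
    where
    E = evalCoeffs N p t
    T = ∑ R N (λ e → p (suc (toℕ e)) * t ^ suc (toℕ e))
    pNtᴺ≈0 : p N * t ^ N ≈ 0#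
    pNtᴺ≈0 = trans (*-congʳ pN≈0) (zeroˡ _)
    expand : ∀ a b s → (a + - v * b) * (t * s) ≈ t * (a * s) + - v * (b * (t * s))
    expand a b s = trans (distribʳ (t * s) a (- v * b))
                         (+-cong (x*[y*z]≈y*[x*z] a t s) (*-assoc (- v) b (t * s)))

  when : ∀ {a} {A : Set a} → Dec A → Carrier → Carrier
  when (yes _) x = x
  when (no  _) _ = 1#

  when-cong : ∀ {a} {A : Set a} (A? : Dec A) {x y} → x ≈ y → when A? x ≈ when A? y
  when-cong (yes _) x≈y = x≈y
  when-cong (no  _) _   = refl

  linearProduct : ∀ {m p} {P : Pred (Fin m) p} → Decidable P → (Fin m → Carrier) → ℕ → Carrier
  linearProduct {zero}  P? v = oneCoeffs
  linearProduct {suc m} P? v with P? zero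
  ... | yes _ = mulLinear (v zero) (linearProduct (P? ∘ suc) (v ∘ suc))
  ... | no  _ = linearProduct (P? ∘ suc) (v ∘ suc)

  linearProduct-coeff : ∀ {m p} {P : Pred (Fin m) p} (P? : Decidable P) v e →
                        count P? < e → linearProduct P? v e ≈ 0#
  linearProduct-coeff {zero}  P? v (suc e) _ = refl
  linearProduct-coeff {suc m} P? v e count<e with P? zero
  linearProduct-coeff {suc m} P? v (suc e) (s≤s count<e) | yes _ =
    trans (+-cong (linearProduct-coeff (P? ∘ suc) (v ∘ suc) e count<e)
                  (trans (*-congˡ (linearProduct-coeff (P? ∘ suc) (v ∘ suc) (suc e) (m≤n⇒m≤1+n count<e)))
                         (zeroʳ _)))
          (+-identityʳ 0#)
  ... | no _ = linearProduct-coeff (P? ∘ suc) (v ∘ suc) e count<e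

  evalCoeffs-linearProduct : ∀ {m p} {P : Pred (Fin m) p} (P? : Decidable P) v N t → count P? < N →
                             evalCoeffs N (linearProduct P? v) t ≈ ∏ R m (λ d → when (P? d) (t - v d))
  evalCoeffs-linearProduct {zero}  P? v (suc N) t _ =
    trans (+-cong (*-identityˡ 1#) (∑-zero N (λ _ → zeroˡ _))) (+-identityʳ 1#)
  evalCoeffs-linearProduct {suc m} P? v N t count<N with P? zero
  evalCoeffs-linearProduct {suc m} P? v (suc N) t (s≤s count<N) | yes _ =
    trans (evalCoeffs-mulLinear N (v zero) (linearProduct (P? ∘ suc) (v ∘ suc)) t
                                (linearProduct-coeff (P? ∘ suc) (v ∘ suc) N count<N))
          (*-congˡ (evalCoeffs-linearProduct (P? ∘ suc) (v ∘ suc) N t count<N))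
  ... | no _ = trans (evalCoeffs-linearProduct (P? ∘ suc) (v ∘ suc) N t count<N) (sym (*-identityˡ _))

module TensorInterpolant {r ℓ} (R : CommutativeRing r ℓ) where
  open CommutativeRing R hiding (zero)
  open BigOperators R
  open Univariate R
  open import Relation.Binary.Reasoning.Setoid setoid

  interpolant : ∀ {q n} → ((Fin n → Fin q) → Carrier) → (Fin n → Fin q → ℕ → Carrier) → Poly R q n
  interpolant {q} {n} G M E = ∑ᵉ R q n (λ s → G s * ∏ R n (λ i → M i (s i) (toℕ (E i))))

  interpolant-coeff : ∀ {q n} G M (E : Fin n → Fin q) i →
                      (∀ c → M i c (toℕ (E i)) ≈ 0#) → interpolant G M E ≈ 0#
  interpolant-coeff {q} {n} G M E i M≈0 =
    ∑ᵉ-zero q n (λ s → trans (*-congˡ (∏-zero n _ i (M≈0 (s i)))) (zeroʳ _))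

  eval-interpolant : ∀ {q n} G M x → eval R (interpolant G M) x ≈
                                     ∑ᵉ R q n (λ s → G s * ∏ R n (λ i → evalCoeffs q (M i (s i)) (x i)))
  eval-interpolant {q} {n} G M x = begin
    ∑ᵉ R q n (λ E → interpolant G M E * X E)
      ≈⟨ ∑ᵉ-cong q n (λ E → trans (sym (∑ᵉ-*ʳ q n (X E) _)) (∑ᵉ-cong q n (λ s → *-assoc _ _ _))) ⟩
    ∑ᵉ R q n (λ E → ∑ᵉ R q n (λ s → G s * (∏ R n (λ i → M i (s i) (toℕ (E i))) * X E)))
      ≈⟨ ∑ᵉ-comm q n n _ ⟩
    ∑ᵉ R q n (λ s → ∑ᵉ R q n (λ E → G s * (∏ R n (λ i → M i (s i) (toℕ (E i))) * X E)))
      ≈⟨ ∑ᵉ-cong q n (λ s → trans (∑ᵉ-*ˡ q n (G s) _) (*-congˡ (trans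
           (∑ᵉ-cong q n (λ E → sym (∏-distrib-* n _ _)))
           (∑ᵉ-∏ q n (λ i e → M i (s i) (toℕ e) * x i ^ toℕ e))))) ⟩
    ∑ᵉ R q n (λ s → G s * ∏ R n (λ i → evalCoeffs q (M i (s i)) (x i))) ∎
    where
    X : (Fin n → Fin q) → Carrier
    X E = ∏ R n (λ i → x i ^ toℕ (E i))

module SetAt {r ℓ} (R : CommutativeRing r ℓ) where
  open CommutativeRing R

  setAt-self : ∀ {n} (x : Fin n → Carrier) i v → setAt R x i v i ≡ v
  setAt-self x i v with i Fin.≟ i
  ... | yes _   = ≡.refl
  ... | no  i≢i = contradiction ≡.refl i≢i

  setAt-≈ : ∀ {n} (x : Fin n → Carrier) i {v} → x i ≈ v → ∀ j → setAt R x i v j ≈ x j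
  setAt-≈ x i xᵢ≈v j with j Fin.≟ i
  ... | yes ≡.refl = sym xᵢ≈v
  ... | no  _      = refl

module FiniteField {r ℓ} {R : CommutativeRing r ℓ} {q} (𝔽 : IsFiniteField R q) where
  open CommutativeRing R hiding (zero)
  open IsFiniteField 𝔽
  open BigOperators R
  open Univariate R
  open TensorInterpolant R
  open SetAt R
  open GroupProperties +-group using (x∙y⁻¹≈ε⇒x≈y; x≈y⇒x∙y⁻¹≈ε; //-rightDividesˡ)
  open import Relation.Binary.Reasoning.Setoid setoid

  enum : Fin q → Carrier
  enum = Bijection.to enumeration

  index : Carrier → Fin q
  index y = proj₁ (Bijection.surjective enumeration y)

  enum-index : ∀ y → enum (index y) ≈ y
  enum-index y = proj₂ (Bijection.surjective enumeration y) ≡.refl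

  enum-injective : ∀ {d d′} → enum d ≈ enum d′ → d ≡ d′
  enum-injective = Bijection.injective enumeration

  infix 4 _≟_
  _≟_ : Decidable₂ _≈_
  x ≟ y with index x Fin.≟ index y
  ... | yes ix≡iy = yes (trans (sym (enum-index x)) (trans (reflexive (≡.cong enum ix≡iy)) (enum-index y)))
  ... | no  ix≢iy = no λ x≈y → ix≢iy (enum-injective (trans (enum-index x) (trans x≈y (sym (enum-index y)))))

  x*y≈0⇒y≈0 : ∀ {x y} → ¬ x ≈ 0# → x * y ≈ 0# → y ≈ 0#
  x*y≈0⇒y≈0 {x} {y} x≉0 xy≈0 with inverse x x≉0
  ... | x⁻¹ , xx⁻¹≈1 = begin
    y              ≈⟨ *-identityˡ y ⟨
    1# * y         ≈⟨ *-congʳ (trans (sym xx⁻¹≈1) (*-comm x x⁻¹)) ⟩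
    x⁻¹ * x * y    ≈⟨ *-assoc x⁻¹ x y ⟩
    x⁻¹ * (x * y)  ≈⟨ *-congˡ xy≈0 ⟩
    x⁻¹ * 0#       ≈⟨ zeroʳ x⁻¹ ⟩
    0#             ∎

  *-≉0 : ∀ {x y} → ¬ x ≈ 0# → ¬ y ≈ 0# → ¬ x * y ≈ 0#
  *-≉0 x≉0 y≉0 = y≉0 ∘ x*y≈0⇒y≈0 x≉0

  ∏-≉0 : ∀ m (g : Fin m → Carrier) → (∀ i → ¬ g i ≈ 0#) → ¬ ∏ R m g ≈ 0#
  ∏-≉0 zero    g g≉0 = 1≉0
  ∏-≉0 (suc m) g g≉0 = *-≉0 (g≉0 zero) (∏-≉0 m (g ∘ suc) (g≉0 ∘ suc))

  x-y≉0 : ∀ {x y} → ¬ x ≈ y → ¬ x - y ≈ 0#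
  x-y≉0 x≉y = x≉y ∘ x∙y⁻¹≈ε⇒x≈y _ _

  -- inv 0 = 0: this junk value makes the basis polynomials below vanish at the points of A.
  inv : Carrier → Carrier
  inv x with x ≟ 0#
  ... | yes _   = 0#
  ... | no  x≉0 = proj₁ (inverse x x≉0)

  inv-inverseʳ : ∀ {x} → ¬ x ≈ 0# → x * inv x ≈ 1#
  inv-inverseʳ {x} x≉0 with x ≟ 0#
  ... | yes x≈0 = contradiction x≈0 x≉0
  ... | no  x≉0 = proj₂ (inverse x x≉0)

  inv-zero : ∀ {x} → x ≈ 0# → inv x ≈ 0#
  inv-zero {x} x≈0 with x ≟ 0#
  ... | yes _   = refl
  ... | no  x≉0 = contradiction x≈0 x≉0

  module LagrangeBasis {k} (a : Fin k → Carrier) (a-injective : ∀ j j′ → a j ≈ a j′ → j ≡ j′) where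

    Avoids : Pred Carrier ℓ
    Avoids t = ¬ ∃ λ j → t ≈ a j

    avoids-enum-index : ∀ {t} → Avoids t → Avoids (enum (index t))
    avoids-enum-index {t} t∉A (j , e) = t∉A (j , trans (sym (enum-index t)) e)

    vanishing : Carrier → Carrier
    vanishing t = ∏ R k (λ j → t - a j)

    vanishing-cong : ∀ {t t′} → t ≈ t′ → vanishing t ≈ vanishing t′
    vanishing-cong t≈t′ = ∏-cong k (λ j → +-congʳ t≈t′)

    vanishing-root : ∀ {t} j → t ≈ a j → vanishing t ≈ 0#
    vanishing-root j t≈aj = ∏-zero k _ j (x≈y⇒x∙y⁻¹≈ε t≈aj)

    vanishing≉0 : ∀ {t} → Avoids t → ¬ vanishing t ≈ 0#
    vanishing≉0 t∉A = ∏-≉0 k _ (λ j → x-y≉0 (λ t≈aj → t∉A (j , t≈aj)))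

    Node : Fin q → Pred (Fin q) ℓ
    Node c d = Avoids (enum d) × d ≢ c

    node? : ∀ c → Decidable (Node c)
    node? c d = ¬? (Fin.any? (λ j → enum d ≟ a j)) ×-dec ¬? (d Fin.≟ c)

    nodeProduct : Fin q → Carrier → Carrier
    nodeProduct c t = ∏ R q (λ d → when (node? c d) (t - enum d))

    scale : Fin q → Carrier
    scale c = inv (nodeProduct c (enum c) * vanishing (enum c))

    -- The polynomial M_c of the header, as a coefficient function.
    basis : Fin q → ℕ → Carrier
    basis c e = scale c * linearProduct (node? c) enum e

    count-node : ∀ c → Avoids (enum c) → suc (count (node? c)) +ℕ k ≤ q
    count-node c c∉A = ≡.subst (_≤ q) (+-suc _ k) (count-+-injection≤ (node? c) g g-injective g∉Node)
      where
      g : Fin (suc k) → Fin q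
      g zero    = c
      g (suc j) = index (a j)
      c≢index : ∀ j → c ≢ index (a j)
      c≢index j c≡ = c∉A (j , trans (reflexive (≡.cong enum c≡)) (enum-index (a j)))
      g-injective : Injective _≡_ _≡_ g
      g-injective {zero}  {zero}   _ = ≡.refl
      g-injective {zero}  {suc j′} e = contradiction e (c≢index j′)
      g-injective {suc j} {zero}   e = contradiction (≡.sym e) (c≢index j)
      g-injective {suc j} {suc j′} e = ≡.cong suc (a-injective j j′
        (trans (sym (enum-index (a j))) (trans (reflexive (≡.cong enum e)) (enum-index (a j′)))))
      g∉Node : ∀ j → ¬ Node c (g j)
      g∉Node zero    (_ , c≢c) = c≢c ≡.refl
      g∉Node (suc j) (a∉A , _) = a∉A (j , enum-index (a j))

    scale-root : ∀ {c} j → enum c ≈ a j → scale c ≈ 0#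
    scale-root j c≈aj = inv-zero (trans (*-congˡ (vanishing-root j c≈aj)) (zeroʳ _))

    basis-coeff : ∀ c e → q ≤ e +ℕ k → basis c e ≈ 0#
    basis-coeff c e q≤e+k with Fin.any? (λ j → enum c ≟ a j)
    ... | yes (j , c≈aj) = trans (*-congʳ (scale-root j c≈aj)) (zeroˡ _)
    ... | no  c∉A = trans (*-congˡ (linearProduct-coeff (node? c) enum e count<e)) (zeroʳ _)
      where
      count<e : count (node? c) < e
      count<e = +-cancelʳ-≤ k _ e (≤-trans (count-node c c∉A) q≤e+k)

    evalCoeffs-basis : ∀ c t → evalCoeffs q (basis c) t ≈ scale c * evalCoeffs q (linearProduct (node? c) enum) t
    evalCoeffs-basis c = evalCoeffs-*ˡ q (scale c) (linearProduct (node? c) enum)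

    evalCoeffs-basis-node : ∀ c t → Avoids (enum c) → evalCoeffs q (basis c) t ≈ scale c * nodeProduct c t
    evalCoeffs-basis-node c t c∉A = trans (evalCoeffs-basis c t)
      (*-congˡ (evalCoeffs-linearProduct (node? c) enum q t (≤-trans (m≤m+n _ k) (count-node c c∉A))))

    evalCoeffs-basis-off : ∀ {t} c → Avoids t → c ≢ index t → evalCoeffs q (basis c) t ≈ 0#
    evalCoeffs-basis-off {t} c t∉A c≢t with Fin.any? (λ j → enum c ≟ a j)
    ... | yes (j , c≈aj) = trans (evalCoeffs-basis c t) (trans (*-congʳ (scale-root j c≈aj)) (zeroˡ _))
    ... | no  c∉A = trans (evalCoeffs-basis-node c t c∉A)
                          (trans (*-congˡ (∏-zero q _ (index t) factor≈0)) (zeroʳ _))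
      where
      factor≈0 : when (node? c (index t)) (t - enum (index t)) ≈ 0#
      factor≈0 with node? c (index t)
      ... | yes _     = x≈y⇒x∙y⁻¹≈ε (sym (enum-index t))
      ... | no  ¬node = contradiction (avoids-enum-index t∉A , c≢t ∘ ≡.sym) ¬node

    evalCoeffs-basis-diag : ∀ {t} → Avoids t → evalCoeffs q (basis (index t)) t * vanishing t ≈ 1#
    evalCoeffs-basis-diag {t} t∉A = begin
      evalCoeffs q (basis c) t * vanishing t
        ≈⟨ *-cong (evalCoeffs-basis-node c t c∉A) (vanishing-cong (sym (enum-index t))) ⟩
      scale c * nodeProduct c t * vanishing (enum c)
        ≈⟨ *-congʳ (*-congˡ (∏-cong q (λ d → when-cong (node? c d) (+-congʳ (sym (enum-index t)))))) ⟩
      scale c * nodeProduct c (enum c) * vanishing (enum c)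
        ≈⟨ trans (*-assoc _ _ _) (*-comm _ _) ⟩
      nodeProduct c (enum c) * vanishing (enum c) * scale c
        ≈⟨ inv-inverseʳ (*-≉0 nodeProduct≉0 (vanishing≉0 c∉A)) ⟩
      1# ∎
      where
      c = index t
      c∉A = avoids-enum-index t∉A
      factor≉0 : ∀ d → ¬ when (node? c d) (enum c - enum d) ≈ 0#
      factor≉0 d with node? c d
      ... | yes (_ , d≢c) = x-y≉0 (d≢c ∘ ≡.sym ∘ enum-injective)
      ... | no  _         = 1≉0
      nodeProduct≉0 : ¬ nodeProduct c (enum c) ≈ 0#
      nodeProduct≉0 = ∏-≉0 q _ factor≉0

  module Characterisation {n} {k : Fin n → ℕ} (a : ∀ i → Fin (k i) → Carrier)
                          (a-injective : ∀ i j j′ → a i j ≈ a i j′ → j ≡ j′) where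

    module Axis (i : Fin n) = LagrangeBasis (a i) (a-injective i)

    vanishingAll : (Fin n → Carrier) → Carrier
    vanishingAll x = ∏ R n (λ i → Axis.vanishing i (x i))

    lagrange : ((Fin n → Fin q) → Carrier) → Poly R q n
    lagrange G = interpolant G Axis.basis

    lagrange-degree : (∀ i → k i ≤ q) → ∀ G i → DegLe R (lagrange G) i (+ q -ℤ + k i -ℤ 1ℤ)
    lagrange-degree k≤q G i E bound<E =
      interpolant-coeff G Axis.basis E i (λ c → Axis.basis-coeff i c _ (degree-bound (k≤q i) bound<E))

    eval-lagrange : ∀ G → (∀ s s′ → (∀ i → s i ≡ s′ i) → G s ≈ G s′) →
                    ∀ x → (∀ i → Axis.Avoids i (x i)) →
                    eval R (lagrange G) x * vanishingAll x ≈ G (index ∘ x)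
    eval-lagrange G G-cong x x∉A = begin
      eval R (lagrange G) x * vanishingAll x
        ≈⟨ *-congʳ (eval-interpolant G Axis.basis x) ⟩
      ∑ᵉ R q n (λ s → G s * ∏ R n (M s)) * vanishingAll x
        ≈⟨ ∑ᵉ-*ʳ q n _ _ ⟨
      ∑ᵉ R q n (λ s → G s * ∏ R n (M s) * vanishingAll x)
        ≈⟨ ∑ᵉ-cong q n (λ s → trans (*-assoc _ _ _) (*-congˡ (sym (∏-distrib-* n _ _)))) ⟩
      ∑ᵉ R q n (λ s → G s * ∏ R n (MP s))
        ≈⟨ ∑ᵉ-eq-single q n _ (index ∘ x) term-cong term-off ⟩
      G (index ∘ x) * ∏ R n (MP (index ∘ x))
        ≈⟨ *-congˡ (∏-one n (λ i → Axis.evalCoeffs-basis-diag i (x∉A i))) ⟩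
      G (index ∘ x) * 1#
        ≈⟨ *-identityʳ _ ⟩
      G (index ∘ x) ∎
      where
      M : (Fin n → Fin q) → Fin n → Carrier
      M s i = evalCoeffs q (Axis.basis i (s i)) (x i)
      MP : (Fin n → Fin q) → Fin n → Carrier
      MP s i = M s i * Axis.vanishing i (x i)
      term-cong : ∀ s s′ → (∀ i → s i ≡ s′ i) → G s * ∏ R n (MP s) ≈ G s′ * ∏ R n (MP s′)
      term-cong s s′ s≗s′ = *-cong (G-cong s s′ s≗s′)
        (∏-cong n (λ i → reflexive (≡.cong (λ d → MP (λ _ → d) i) (s≗s′ i))))
      term-off : ∀ s i → s i ≢ index (x i) → G s * ∏ R n (MP s) ≈ 0#
      term-off s i sᵢ≢ = trans (*-congˡ (∏-zero n _ i
        (trans (*-congʳ (Axis.evalCoeffs-basis-off i (s i) (x∉A i) sᵢ≢)) (zeroˡ _)))) (zeroʳ _)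

    module _ (b : Carrier) {f : (Fin n → Carrier) → Carrier} (f-cong : FunCongruent R f) where

      gridValue : (Fin n → Fin q) → Carrier
      gridValue s = f (enum ∘ s) - b

      gridValue-cong : ∀ s s′ → (∀ i → s i ≡ s′ i) → gridValue s ≈ gridValue s′
      gridValue-cong s s′ s≗s′ = +-congʳ (f-cong _ _ (λ i → reflexive (≡.cong enum (s≗s′ i))))

      inC⇒lagrange : (∀ i j → InC R i (a i j) b f) →
                     ∀ x → f x ≈ eval R (lagrange gridValue) x * vanishingAll x + b
      inC⇒lagrange f∈C x with Fin.any? (λ i → Fin.any? (λ j → x i ≟ a i j))
      ... | yes (i , j , xᵢ≈aᵢⱼ) = begin
        f x                                              ≈⟨ f-cong _ _ (setAt-≈ x i xᵢ≈aᵢⱼ) ⟨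
        f (setAt R x i (a i j))                          ≈⟨ f∈C i j x ⟩
        b                                                ≈⟨ +-identityˡ b ⟨
        0# + b                                           ≈⟨ +-congʳ (trans (*-congˡ vanishes) (zeroʳ _)) ⟨
        eval R (lagrange gridValue) x * vanishingAll x + b ∎
        where
        vanishes : vanishingAll x ≈ 0#
        vanishes = ∏-zero n _ i (Axis.vanishing-root i j xᵢ≈aᵢⱼ)
      ... | no x-avoids = begin
        f x                                              ≈⟨ f-cong _ _ (λ i → enum-index (x i)) ⟨
        f (enum ∘ index ∘ x)                             ≈⟨ //-rightDividesˡ b _ ⟨
        gridValue (index ∘ x) + b                        ≈⟨ +-congʳ (eval-lagrange gridValue gridValue-cong x
                                                               (λ i (j , e) → x-avoids (i , j , e))) ⟨
        eval R (lagrange gridValue) x * vanishingAll x + b ∎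

    lagrange⇒inC : ∀ b {f : (Fin n → Carrier) → Carrier} (Q : Poly R q n) →
                   (∀ x → f x ≈ eval R Q x * vanishingAll x + b) → ∀ i j → InC R i (a i j) b f
    lagrange⇒inC b {f} Q f≈ i j x = begin
      f y                             ≈⟨ f≈ y ⟩
      eval R Q y * vanishingAll y + b ≈⟨ +-congʳ (trans (*-congˡ vanishes) (zeroʳ _)) ⟩
      0# + b                          ≈⟨ +-identityˡ b ⟩
      b                               ∎
      where
      y = setAt R x i (a i j)
      vanishes : vanishingAll y ≈ 0#
      vanishes = ∏-zero n _ i (Axis.vanishing-root i j (reflexive (setAt-self x i (a i j))))

lemma3p11 : ∀ {c ℓ} (R : CommutativeRing c ℓ) (q : ℕ) → IsFiniteField R q →
    (n : ℕ) → 1 ≤ n → (b : CommutativeRing.Carrier R) →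
    (k : Fin n → ℕ) → (∀ i → k i ≤ q) →
    (a : (i : Fin n) → Fin (k i) → CommutativeRing.Carrier R) →
    (∀ i j j′ → CommutativeRing._≈_ R (a i j) (a i j′) → j ≡ j′) →
    (f : (Fin n → CommutativeRing.Carrier R) → CommutativeRing.Carrier R) →
    FunCongruent R f →
    ((∀ i j → InC R i (a i j) b f)
      ⇔ ∃ λ (Q : Poly R q n) →
          (∀ i → DegLe R Q i (+ q -ℤ + k i -ℤ 1ℤ))
          × (∀ x → CommutativeRing._≈_ R (f x)
              (CommutativeRing._+_ R
                (CommutativeRing._*_ R (eval R Q x)
                  (∏ R n (λ i → ∏ R (k i) (λ j → CommutativeRing._-_ R (x i) (a i j)))))
                b)))
lemma3p11 R q 𝔽 n _ b k k≤q a a-injective f f-cong =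
  mk⇔ (λ f∈C → lagrange G , lagrange-degree k≤q G , inC⇒lagrange b f-cong f∈C)
      (λ (Q , _ , f≈) → lagrange⇒inC b Q f≈)
  where
  open FiniteField.Characterisation 𝔽 a a-injective
  G = gridValue b f-cong
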